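{- A threshold Boolean function $f$ is linear read-once if and only if no restriction of $f$ coincides, up to renaming of variables, with a function in $\mathcal{G}$, where $\mathcal{G}$ is the set of all functions $g_n(x_1,\ldots,x_n)=x_1x_2\vee x_1x_3\vee\cdots\vee x_1x_n\vee x_2x_3\cdots x_n$ ($n\ge3$) together with all functions obtained from them by negating some of the variables.
   Context: $f$ on $B^n$ ($B=\{0,1\}$) is a threshold function if there are reals $w_1,\ldots,w_n,t$ with $f(\mathbf{x})=0\iff\sum w_ix_i\le t$ for all $\mathbf{x}\in B^n$. A function is linear read-once (lro) if it is constant or representable by a nested formula: literals $x,\overline{x}$ are nested formulas, and if $t$ is a nested formula not containing $x$ or $\overline{x}$ then $x\vee t$, $x\wedge t$, $\overline{x}\vee t$, $\overline{x}\wedge t$ are nested formulas. A restriction of $f$ is a function obtained by fixing some of its variables to constants in $\{0,1\}$.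
   Formalization: The weights $w_1,\ldots,w_n$ and the threshold $t$ of a threshold function are rational instead of real. -}

module Defs where

open import Data.Bool using (Bool; true; false; _∧_; _∨_; _xor_; if_then_else_)
open import Data.Nat using (ℕ; zero; suc; _≥_)
open import Data.Fin using (Fin; zero; suc)
open import Data.List using (List; []; _∷_)
open import Data.List.Membership.Propositional using (_∉_)
open import Data.Rational using (ℚ; 0ℚ; _+_; _≤_)
open import Data.Product using (Σ; ∃; ∃-syntax; _×_; _,_)
open import Data.Sum using (_⊎_)
open import Function.Bundles using (_⇔_)
open import Function.Definitions using (Injective)
open import Relation.Binary.PropositionalEquality using (_≡_; _≢_)
open import Relation.Nullary using (¬_)
open import Data.Empty using (⊥)

BoolFun : ℕ → Set
BoolFun n = (Fin n → Bool) → Bool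

anyᶠ : ∀ {n} → (Fin n → Bool) → Bool
anyᶠ {zero}  y = false
anyᶠ {suc n} y = y zero ∨ anyᶠ (λ i → y (suc i))

allᶠ : ∀ {n} → (Fin n → Bool) → Bool
allᶠ {zero}  y = true
allᶠ {suc n} y = y zero ∧ allᶠ (λ i → y (suc i))

sumᶠ : ∀ {n} → (Fin n → ℚ) → ℚ
sumᶠ {zero}  a = 0ℚ
sumᶠ {suc n} a = a zero + sumᶠ (λ i → a (suc i))

IsThreshold : ∀ {n} → BoolFun n → Set
IsThreshold {n} f =
  Σ (Fin n → ℚ) λ w → Σ ℚ λ t →
    ∀ (x : Fin n → Bool) →
      (f x ≡ false) ⇔ (sumᶠ (λ i → if x i then w i else 0ℚ) ≤ t)

-- Nested formulas, indexed by the list of variables they contain.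
-- lit i b     : the literal x_i (b = true) or ¬x_i (b = false)
-- node i b c φ : ℓ ∨ φ (c = true) or ℓ ∧ φ (c = false), where ℓ is
--                the literal (i , b), and x_i does not occur in φ.

data Nested (n : ℕ) : List (Fin n) → Set where
  lit  : (i : Fin n) (b : Bool) → Nested n (i ∷ [])
  node : ∀ {vs} (i : Fin n) (b : Bool) (c : Bool) →
         Nested n vs → i ∉ vs → Nested n (i ∷ vs)

literal : ∀ {n} → Fin n → Bool → (Fin n → Bool) → Bool
literal i true  x = x i
literal i false x = x i xor true

evalN : ∀ {n vs} → Nested n vs → (Fin n → Bool) → Bool
evalN (lit i b) x = literal i b x
evalN (node i b true  φ _) x = literal i b x ∨ evalN φ x
evalN (node i b false φ _) x = literal i b x ∧ evalN φ x

IsLRO : ∀ {n} → BoolFun n → Set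
IsLRO {n} f =
  (Σ Bool λ b → ∀ x → f x ≡ b)
  ⊎ (Σ (List (Fin n)) λ vs → Σ (Nested n vs) λ φ → ∀ x → f x ≡ evalN φ x)

-- g_m(x_1..x_m) = x_1x_2 ∨ ... ∨ x_1x_m ∨ x_2x_3...x_m, variable x_1
-- being index zero.

gfun : ∀ {k} → BoolFun (suc k)
gfun y = (y zero ∧ anyᶠ (λ i → y (suc i))) ∨ allᶠ (λ i → y (suc i))

In𝒢 : ∀ {m} → BoolFun m → Set
In𝒢 {zero}  h = ⊥
In𝒢 {suc k} h = suc k ≥ 3 × Σ (Fin (suc k) → Bool) λ neg →
                  ∀ y → h y ≡ gfun (λ j → y j xor neg j)

-- Restrictions up to renaming.
-- σ : Fin m → Fin n (injective) lists the free variables of the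
-- restriction (and renames them to y_0..y_{m-1}); every other
-- variable i is fixed to the constant c i.

RestrictsTo : ∀ {n m} → BoolFun n → (Fin m → Fin n) → (Fin n → Bool)
              → BoolFun m → Set
RestrictsTo {n} {m} f σ c h =
  ∀ (y : Fin m → Bool) (x : Fin n → Bool) →
    (∀ j → x (σ j) ≡ y j) →
    (∀ i → (∀ j → σ j ≢ i) → x i ≡ c i) →
    f x ≡ h y

Has𝒢Restriction : ∀ {n} → BoolFun n → Set
Has𝒢Restriction {n} f =
  ∃[ m ] Σ (Fin m → Fin n) λ σ → Injective _≡_ _≡_ σ ×
    Σ (Fin n → Bool) λ c → Σ (BoolFun m) λ h →
      RestrictsTo f σ c h × In𝒢 h

{-# OPTIONS --safe #-}
-- Every restriction of an lro function is constant or has a canalizing variable: the outermost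
-- literal of its nested formula whose variable is not fixed. No function of 𝒢 is constant or
-- canalizing, so lro functions have no restriction in 𝒢.
--
-- Conversely, negating the variables of negative weight makes all weights u_i nonnegative, and we
-- induct on n. If u_i > t or Σ_{j≠i} u_j ≤ t, then x_i canalizes f, so f = x_i ∨ g or f = x_i ∧ g for
-- the threshold restriction g at the other value of x_i, and induction applies to g. Otherwise every
-- restriction f|x_i=c maps each constant point b to b. If all these restrictions are lro, the outer
-- literal of each gives a partner k ≠ i such that x_i = x_k = c forces f = c. Whether a pair forces 1
-- (t < u_i + u_k) or forces 0 (Σ u_j ≤ t + u_i + u_k) depends monotonically on u_i + u_k, so every
-- variable forms a forcing pair, for both values, with a variable x_a of maximal weight; this says
-- precisely that f is g_n with x_a as its first variable, and n ≥ 3 since n ≤ 2 is contradictory.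
module Submission where

open import Defs
import Algebra.Properties.Group as GroupProperties
open import Data.Bool using (Bool; true; false; not; _∧_; _∨_; _xor_; if_then_else_; f≤t; b≤b)
  renaming (_≤_ to _≤ᵇ_; _≟_ to _≟ᵇ_)
open import Data.Bool.Properties
  using (¬-not; not-¬; xor-comm; xor-assoc; xor-same; xor-identityʳ; not-distribˡ-xor;
         ∨-zeroʳ; ∧-zeroʳ; ≤-minimum; ≤-maximum)
open import Data.Empty using (⊥-elim)
open import Data.Fin using (Fin; zero; suc; punchIn; punchOut; _≟_)
open import Data.Fin.Properties
  using (any?; punchInᵢ≢i; punchIn-injective; punchIn-punchOut; suc-injective)
open import Data.List using (map; allFin)
open import Data.List.Membership.Propositional using (_∈_; _∉_)
open import Data.List.Membership.Propositional.Properties using (∈-map⁻; ∈-allFin)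
import Data.List.Relation.Unary.All as All
open import Data.Nat using (ℕ; zero; suc; _≥_; s≤s; z≤n)
open import Data.Product using (∃; ∃₂; _×_; _,_; proj₁; proj₂)
open import Data.Rational using (ℚ; 0ℚ; _+_; _-_; -_; _≤_; _<_)
import Data.Rational.Properties as ℚₚ
open import Data.Sum using (_⊎_; inj₁; inj₂; [_,_]′; fromInj₁) renaming (map to ⊎-map)
open import Data.Vec.Functional using (Vector; _∷_; insertAt; removeAt; updateAt)
open import Data.Vec.Functional.Properties
  using (insertAt-lookup; insertAt-punchIn; insertAt-removeAt; removeAt-insertAt;
         removeAt-punchOut; updateAt-updates; updateAt-minimal)
open import Function using (_∘_; const; id)
open import Function.Bundles using (_⇔_; mk⇔; Equivalence)
open import Function.Definitions using (Injective)
import Function.Properties.Equivalence as Equiv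
open import Relation.Binary.PropositionalEquality
open import Relation.Binary.Bundles using (DecTotalOrder)
open import Relation.Nullary using (¬_; yes; no; contradiction)

open import Algebra.Properties.CommutativeMonoid.Sum ℚₚ.+-0-commutativeMonoid
  using (sum; sum-cong-≗; sum-remove; ∑-distrib-+; sum-replicate-zero)
open GroupProperties ℚₚ.+-0-group using (//-rightDividesˡ; //-rightDividesʳ)
open import Data.List.Extrema (DecTotalOrder.totalOrder ℚₚ.≤-decTotalOrder)
  using (argmax; f[xs]≤f[argmax])

private variable
  m n : ℕ

-- Rational arithmetic and weighted sums

<⇒≱ : ∀ {p q : ℚ} → p < q → ¬ q ≤ p
<⇒≱ p<q q≤p = ℚₚ.<-irrefl refl (ℚₚ.<-≤-trans p<q q≤p)

+-cancelʳ-≤ : ∀ {p q} r → p + r ≤ q + r → p ≤ q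
+-cancelʳ-≤ r p+r≤q+r = ℚₚ.≮⇒≥ λ q<p → <⇒≱ (ℚₚ.+-monoˡ-< r q<p) p+r≤q+r

p+r≤q⇔p≤q-r : ∀ {p q} r → (p + r ≤ q) ⇔ (p ≤ q - r)
p+r≤q⇔p≤q-r {p} {q} r = mk⇔
  (λ p+r≤q → subst (_≤ q - r) (//-rightDividesʳ r p) (ℚₚ.+-monoˡ-≤ (- r) p+r≤q))
  (λ p≤q-r → subst (p + r ≤_) (//-rightDividesˡ r q) (ℚₚ.+-monoˡ-≤ r p≤q-r))

sum-mono-≤ : ∀ {a b : Vector ℚ n} → (∀ i → a i ≤ b i) → sum a ≤ sum b
sum-mono-≤ {zero}  _   = ℚₚ.≤-refl
sum-mono-≤ {suc n} a≤b = ℚₚ.+-mono-≤ (a≤b zero) (sum-mono-≤ (a≤b ∘ suc))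

sumᶠ≡sum : (a : Vector ℚ n) → sumᶠ a ≡ sum a
sumᶠ≡sum {zero}  a = refl
sumᶠ≡sum {suc n} a = cong (a zero +_) (sumᶠ≡sum (a ∘ suc))

infix 7 _·ᵇ_
_·ᵇ_ : Bool → ℚ → ℚ
b ·ᵇ q = if b then q else 0ℚ

weight : Vector ℚ n → Vector Bool n → ℚ
weight u x = sum λ i → x i ·ᵇ u i

Nonnegative : Vector ℚ n → Set
Nonnegative u = ∀ i → 0ℚ ≤ u i

Represents : Vector ℚ n → ℚ → BoolFun n → Set
Represents u t F = ∀ x → (F x ≡ false) ⇔ (weight u x ≤ t)

isThreshold⇒represents : {f : BoolFun n} → IsThreshold f → ∃₂ λ w t → Represents w t f
isThreshold⇒represents {f = f} (w , t , rep) =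
  w , t , λ x → subst (λ s → (f x ≡ false) ⇔ (s ≤ t)) (sumᶠ≡sum (λ i → x i ·ᵇ w i)) (rep x)

·ᵇ-mono : ∀ {a b q} → 0ℚ ≤ q → a ≤ᵇ b → a ·ᵇ q ≤ b ·ᵇ q
·ᵇ-mono 0≤q f≤t = 0≤q
·ᵇ-mono 0≤q b≤b = ℚₚ.≤-refl

·ᵇ-≤ : ∀ b {q} → 0ℚ ≤ q → b ·ᵇ q ≤ q
·ᵇ-≤ b 0≤q = ·ᵇ-mono 0≤q (≤-maximum b)

·ᵇ-nonneg : ∀ b {q} → 0ℚ ≤ q → 0ℚ ≤ b ·ᵇ q
·ᵇ-nonneg b 0≤q = ·ᵇ-mono 0≤q (≤-minimum b)

weight-cong : ∀ (u : Vector ℚ n) {x y} → x ≗ y → weight u x ≡ weight u y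
weight-cong u x≗y = sum-cong-≗ λ i → cong (_·ᵇ u i) (x≗y i)

weight-zero : ∀ (u : Vector ℚ n) {x} → (∀ i → x i ≡ false) → weight u x ≡ 0ℚ
weight-zero {n} u x≡0 = trans (weight-cong u x≡0) (sum-replicate-zero n)

weight-mono : ∀ {u : Vector ℚ n} {x y} → Nonnegative u → (∀ i → x i ≤ᵇ y i) → weight u x ≤ weight u y
weight-mono u≥0 x≤y = sum-mono-≤ λ i → ·ᵇ-mono (u≥0 i) (x≤y i)

weight-nonneg : ∀ {u : Vector ℚ n} → Nonnegative u → ∀ x → 0ℚ ≤ weight u x
weight-nonneg {u = u} u≥0 x =
  subst (_≤ weight u x) (weight-zero u {const false} λ _ → refl) (weight-mono u≥0 (≤-minimum ∘ x))

weight-≤-sum : ∀ {u : Vector ℚ n} → Nonnegative u → ∀ x → weight u x ≤ sum u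
weight-≤-sum u≥0 x = weight-mono u≥0 (≤-maximum ∘ x)

weight-+-weight-not : ∀ (u : Vector ℚ n) x → weight u x + weight u (not ∘ x) ≡ sum u
weight-+-weight-not u x =
  trans (sym (∑-distrib-+ (λ i → x i ·ᵇ u i) (λ i → not (x i) ·ᵇ u i)))
        (sum-cong-≗ λ i → split (x i) (u i))
  where
  split : ∀ b q → b ·ᵇ q + not b ·ᵇ q ≡ q
  split true  q = ℚₚ.+-identityʳ q
  split false q = ℚₚ.+-identityˡ q

weight-removeAt : ∀ (u : Vector ℚ (suc n)) x i →
                  weight u x ≡ x i ·ᵇ u i + weight (removeAt u i) (removeAt x i)
weight-removeAt u x i = sum-remove {i = i} λ j → x j ·ᵇ u j

weight-insertAt : ∀ (u : Vector ℚ (suc n)) y i c →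
                  weight u (insertAt y i c) ≡ weight (removeAt u i) y + c ·ᵇ u i
weight-insertAt u y i c = begin
  weight u (insertAt y i c)
    ≡⟨ weight-removeAt u (insertAt y i c) i ⟩
  insertAt y i c i ·ᵇ u i + weight (removeAt u i) (removeAt (insertAt y i c) i)
    ≡⟨ cong₂ (λ b w → b ·ᵇ u i + w) (insertAt-lookup y i c)
             (weight-cong (removeAt u i) (removeAt-insertAt y i c)) ⟩
  c ·ᵇ u i + weight (removeAt u i) y
    ≡⟨ ℚₚ.+-comm (c ·ᵇ u i) (weight (removeAt u i) y) ⟩
  weight (removeAt u i) y + c ·ᵇ u i ∎
  where open ≡-Reasoning

weight-removeAt-true : ∀ (u : Vector ℚ (suc n)) {x i} → x i ≡ true →
                       weight u x ≡ u i + weight (removeAt u i) (removeAt x i)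
weight-removeAt-true u {x} {i} xi≡1 =
  trans (weight-removeAt u x i) (cong (λ b → b ·ᵇ u i + weight (removeAt u i) (removeAt x i)) xi≡1)

weight-removeAt-≤ : ∀ {u : Vector ℚ (suc n)} → Nonnegative u → ∀ x i →
                    weight u x ≤ u i + weight (removeAt u i) (removeAt x i)
weight-removeAt-≤ {u = u} u≥0 x i = ℚₚ.≤-trans (ℚₚ.≤-reflexive (weight-removeAt u x i))
  (ℚₚ.+-monoˡ-≤ (weight (removeAt u i) (removeAt x i)) (·ᵇ-≤ (x i) (u≥0 i)))

weight-≥-single : ∀ {u : Vector ℚ n} → Nonnegative u → ∀ {x i} → x i ≡ true → u i ≤ weight u x
weight-≥-single {zero} _ {i = ()}
weight-≥-single {suc n} {u} u≥0 {x} {i} xi≡1 = begin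
  u i                                        ≡⟨ ℚₚ.+-identityʳ (u i) ⟨
  u i + 0ℚ                                   ≤⟨ ℚₚ.+-monoʳ-≤ (u i) (weight-nonneg (u≥0 ∘ punchIn i) _) ⟩
  u i + weight (removeAt u i) (removeAt x i) ≡⟨ weight-removeAt-true u {x} xi≡1 ⟨
  weight u x                                 ∎
  where open ℚₚ.≤-Reasoning

weight-≤-single : ∀ {u : Vector ℚ n} → Nonnegative u → ∀ {x i} → (∀ j → j ≢ i → x j ≡ false) →
                  weight u x ≤ u i
weight-≤-single {zero} _ {i = ()}
weight-≤-single {suc n} {u} u≥0 {x} {i} x≡0 = begin
  weight u x                                 ≤⟨ weight-removeAt-≤ u≥0 x i ⟩
  u i + weight (removeAt u i) (removeAt x i) ≡⟨ cong (u i +_) (weight-zero (removeAt u i) rest≡0) ⟩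
  u i + 0ℚ                                   ≡⟨ ℚₚ.+-identityʳ (u i) ⟩
  u i                                        ∎
  where
  open ℚₚ.≤-Reasoning
  rest≡0 : ∀ j → removeAt x i j ≡ false
  rest≡0 j = x≡0 (punchIn i j) (punchInᵢ≢i i j)

weight-≥-pair : ∀ {u : Vector ℚ n} → Nonnegative u → ∀ {x i k} → k ≢ i → x i ≡ true → x k ≡ true →
                u i + u k ≤ weight u x
weight-≥-pair {zero} _ {i = ()}
weight-≥-pair {suc n} {u} u≥0 {x} {i} {k} k≢i xi≡1 xk≡1 = begin
  u i + u k                                  ≡⟨ cong (u i +_) (removeAt-punchOut u i≢k) ⟨
  u i + removeAt u i (punchOut i≢k)          ≤⟨ ℚₚ.+-monoʳ-≤ (u i) (weight-≥-single (u≥0 ∘ punchIn i) rest≡1) ⟩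
  u i + weight (removeAt u i) (removeAt x i) ≡⟨ weight-removeAt-true u {x} xi≡1 ⟨
  weight u x                                 ∎
  where
  open ℚₚ.≤-Reasoning
  i≢k = k≢i ∘ sym
  rest≡1 : removeAt x i (punchOut i≢k) ≡ true
  rest≡1 = trans (removeAt-punchOut x i≢k) xk≡1

weight-≤-pair : ∀ {u : Vector ℚ n} → Nonnegative u → ∀ {x i k} → k ≢ i →
                (∀ j → j ≢ i → j ≢ k → x j ≡ false) → weight u x ≤ u i + u k
weight-≤-pair {zero} _ {i = ()}
weight-≤-pair {suc n} {u} u≥0 {x} {i} {k} k≢i x≡0 = begin
  weight u x                                 ≤⟨ weight-removeAt-≤ u≥0 x i ⟩
  u i + weight (removeAt u i) (removeAt x i) ≤⟨ ℚₚ.+-monoʳ-≤ (u i) (weight-≤-single (u≥0 ∘ punchIn i) rest≡0) ⟩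
  u i + removeAt u i (punchOut i≢k)          ≡⟨ cong (u i +_) (removeAt-punchOut u i≢k) ⟩
  u i + u k                                  ∎
  where
  open ℚₚ.≤-Reasoning
  i≢k = k≢i ∘ sym
  rest≡0 : ∀ j → j ≢ punchOut i≢k → removeAt x i j ≡ false
  rest≡0 j j≢k′ = x≡0 (punchIn i j) (punchInᵢ≢i i j)
    λ e → j≢k′ (punchIn-injective i j _ (trans e (sym (punchIn-punchOut i≢k))))

-- Threshold representations and restrictions

≡-by-false : ∀ {a b : Bool} → (a ≡ false ⇔ b ≡ false) → a ≡ b
≡-by-false {false} a⇔b = sym (Equivalence.to a⇔b refl)
≡-by-false {true} {true} _ = refl
≡-by-false {true} {false} a⇔b = Equivalence.from a⇔b refl

Extensional : BoolFun n → Set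
Extensional F = ∀ {x y} → x ≗ y → F x ≡ F y

module Threshold {F : BoolFun n} {u t} (rep : Represents u t F) where

  below⇒false : ∀ {x} → weight u x ≤ t → F x ≡ false
  below⇒false = Equivalence.from (rep _)

  false⇒below : ∀ {x} → F x ≡ false → weight u x ≤ t
  false⇒below = Equivalence.to (rep _)

  above⇒true : ∀ {x} → t < weight u x → F x ≡ true
  above⇒true t<w = ¬-not λ Fx≡0 → <⇒≱ t<w (false⇒below Fx≡0)

  true⇒above : ∀ {x} → F x ≡ true → t < weight u x
  true⇒above Fx≡1 = ℚₚ.≰⇒> λ w≤t → not-¬ Fx≡1 (below⇒false w≤t)

  respects-≗ : Extensional F
  respects-≗ {x} {y} x≗y = ≡-by-false (Equiv.trans (rep x)
    (subst (λ w → (w ≤ t) ⇔ (F y ≡ false)) (sym (weight-cong u x≗y)) (Equiv.sym (rep y))))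

represents-shift : ∀ {w : Vector ℚ m} {u : Vector ℚ n} {F t r} (g : Vector Bool n → Vector Bool m) →
                   (∀ x → weight w (g x) ≡ weight u x + r) → Represents w t F → Represents u (t - r) (F ∘ g)
represents-shift {t = t} {r} g w∘g≡ rep x =
  Equiv.trans (rep (g x)) (subst (λ s → (s ≤ t) ⇔ _) (sym (w∘g≡ x)) (p+r≤q⇔p≤q-r r))

restrict : BoolFun (suc n) → Fin (suc n) → Bool → BoolFun n
restrict F i c y = F (insertAt y i c)

represents-restrict : ∀ {u : Vector ℚ (suc n)} {t F} → Represents u t F →
                      ∀ i c → Represents (removeAt u i) (t - c ·ᵇ u i) (restrict F i c)
represents-restrict {u = u} rep i c =
  represents-shift {w = u} (λ y → insertAt y i c) (λ y → weight-insertAt u y i c) rep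

restrict-removeAt : ∀ {F : BoolFun (suc n)} → Extensional F →
                    ∀ {x i c} → x i ≡ c → F x ≡ restrict F i c (removeAt x i)
restrict-removeAt ext {x} {i} refl = ext λ j → sym (insertAt-removeAt x i j)

-- Canalizing variables and nested formulas

Constant : BoolFun n → Set
Constant F = ∃ λ v → ∀ x → F x ≡ v

Canalizes : BoolFun n → Fin n → Bool → Bool → Set
Canalizes F i b v = ∀ x → x i ≡ b → F x ≡ v

Canalizing : BoolFun n → Set
Canalizing F = ∃ λ i → ∃₂ λ b v → Canalizes F i b v

FixesConstants : BoolFun n → Set
FixesConstants F = ∀ b → F (const b) ≡ b

fixes⇒nonconstant : ∀ {F : BoolFun n} → FixesConstants F → ¬ Constant F
fixes⇒nonconstant fixes (v , F≡v)
  with trans (sym (fixes true)) (trans (F≡v _) (trans (sym (F≡v _)) (fixes false)))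
... | ()

canalizing-value : ∀ {F : BoolFun n} {i b v} → FixesConstants F → Canalizes F i b v → v ≡ b
canalizing-value fixes can = trans (sym (can (const _) refl)) (fixes _)

literal-xor : ∀ (i : Fin n) b x → literal i b x ≡ not b xor x i
literal-xor i true  x = refl
literal-xor i false x = xor-comm (x i) true

literal-cong : ∀ (i : Fin n) b {x y} → x i ≡ y i → literal i b x ≡ literal i b y
literal-cong i true  xi≡yi = xi≡yi
literal-cong i false xi≡yi = cong (_xor true) xi≡yi

literal-attains : ∀ (i : Fin n) b v x → x i ≡ not b xor v → literal i b x ≡ v
literal-attains i b v x xi≡ = begin
  literal i b x           ≡⟨ literal-xor i b x ⟩
  not b xor x i           ≡⟨ cong (not b xor_) xi≡ ⟩
  not b xor (not b xor v) ≡⟨ xor-assoc (not b) (not b) v ⟨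
  (not b xor not b) xor v ≡⟨ cong (_xor v) (xor-same (not b)) ⟩
  v                       ∎
  where open ≡-Reasoning

node-canalizes : ∀ {vs} {i : Fin n} {b} v (φ : Nested n vs) {i∉φ} x →
                 literal i b x ≡ v → evalN (node i b v φ i∉φ) x ≡ v
node-canalizes true  φ x ℓ≡v = cong (_∨ evalN φ x) ℓ≡v
node-canalizes false φ x ℓ≡v = cong (_∧ evalN φ x) ℓ≡v

node-passes : ∀ {vs} {i : Fin n} {b} v (φ : Nested n vs) {i∉φ} x →
              literal i b x ≡ not v → evalN (node i b v φ i∉φ) x ≡ evalN φ x
node-passes true  φ x ℓ≡v = cong (_∨ evalN φ x) ℓ≡v
node-passes false φ x ℓ≡v = cong (_∧ evalN φ x) ℓ≡v

evalN-canalizing : ∀ {vs} (φ : Nested n vs) → Canalizing (evalN φ)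
evalN-canalizing (lit i b)        = i , not b xor true , true , literal-attains i b true
evalN-canalizing (node i b v φ _) =
  i , not b xor v , v , λ x xi≡ → node-canalizes v φ x (literal-attains i b v x xi≡)

∉-map : ∀ {ρ : Fin n → Fin m} → Injective _≡_ _≡_ ρ → ∀ {i vs} → i ∉ vs → ρ i ∉ map ρ vs
∉-map {ρ = ρ} ρ-inj i∉vs ρi∈ with ∈-map⁻ ρ ρi∈
... | j , j∈vs , ρi≡ρj = i∉vs (subst (_∈ _) (sym (ρ-inj ρi≡ρj)) j∈vs)

relabel : ∀ {vs} (ρ : Fin n → Fin m) → Injective _≡_ _≡_ ρ → (Fin n → Bool → Bool) →
          Nested n vs → Nested m (map ρ vs)
relabel ρ ρ-inj β (lit i b)            = lit (ρ i) (β i b)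
relabel ρ ρ-inj β (node i b v φ i∉φ) = node (ρ i) (β i b) v (relabel ρ ρ-inj β φ) (∉-map ρ-inj i∉φ)

evalN-relabel : ∀ {vs} {ρ : Fin n → Fin m} {ρ-inj : Injective _≡_ _≡_ ρ} {β}
                (g : Vector Bool m → Vector Bool n) →
                (∀ i b x → literal (ρ i) (β i b) x ≡ literal i b (g x)) →
                ∀ (φ : Nested n vs) x → evalN (relabel ρ ρ-inj β φ) x ≡ evalN φ (g x)
evalN-relabel g ℓ≡ (lit i b) x = ℓ≡ i b x
evalN-relabel g ℓ≡ (node i b true  φ _) x = cong₂ _∨_ (ℓ≡ i b x) (evalN-relabel g ℓ≡ φ x)
evalN-relabel g ℓ≡ (node i b false φ _) x = cong₂ _∧_ (ℓ≡ i b x) (evalN-relabel g ℓ≡ φ x)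

literal-∘ : ∀ (ρ : Fin n → Fin m) i b x → literal (ρ i) b x ≡ literal i b (x ∘ ρ)
literal-∘ ρ i true  x = refl
literal-∘ ρ i false x = refl

rename : ∀ {vs} (ρ : Fin n → Fin m) → Injective _≡_ _≡_ ρ → Nested n vs → Nested m (map ρ vs)
rename ρ ρ-inj = relabel ρ ρ-inj λ _ b → b

evalN-rename : ∀ {vs} (ρ : Fin n → Fin m) (ρ-inj : Injective _≡_ _≡_ ρ) (φ : Nested n vs) x →
               evalN (rename ρ ρ-inj φ) x ≡ evalN φ (x ∘ ρ)
evalN-rename ρ ρ-inj = evalN-relabel (_∘ ρ) (literal-∘ ρ)

punchIn-∉ : ∀ (i : Fin (suc n)) {vs} → i ∉ map (punchIn i) vs
punchIn-∉ i i∈ with ∈-map⁻ (punchIn i) i∈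
... | j , _ , i≡ = punchInᵢ≢i i j (sym i≡)

canalized-≗ : ∀ {F G : BoolFun n} {i v} → Canalizes F i v v → Canalizes G i v v →
              (∀ x → x i ≡ not v → F x ≡ G x) → ∀ x → F x ≡ G x
canalized-≗ {i = i} {v} F-can G-can off x with x i ≟ᵇ v
... | yes xi≡v = trans (F-can x xi≡v) (sym (G-can x xi≡v))
... | no  xi≢v = off x (¬-not xi≢v)

lro-canalized : ∀ {F : BoolFun (suc n)} {i v} → Extensional F → Canalizes F i v v →
                IsLRO (restrict F i (not v)) → IsLRO F
lro-canalized {v = v} ext can (inj₁ (w , const-w)) with w ≟ᵇ v
... | yes refl = inj₁ (w , canalized-≗ can (λ _ _ → refl) λ x xi →
                   trans (restrict-removeAt ext xi) (const-w _))
... | no  w≢v  = inj₂ (_ , lit _ true , canalized-≗ can (λ _ xi → xi) λ x xi →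
                   trans (restrict-removeAt ext xi) (trans (const-w _) (trans (¬-not w≢v) (sym xi))))
lro-canalized {F = F} {i} {v} ext can (inj₂ (_ , φ , restriction≡φ)) =
  inj₂ (_ , node i true v φ′ (punchIn-∉ i) , canalized-≗ can (λ x → node-canalizes v φ′ x) λ x xi → begin
    F x                                        ≡⟨ restrict-removeAt ext xi ⟩
    restrict F i (not v) (removeAt x i)        ≡⟨ restriction≡φ _ ⟩
    evalN φ (removeAt x i)                     ≡⟨ evalN-rename (punchIn i) ρ-inj φ x ⟨
    evalN φ′ x                                 ≡⟨ node-passes v φ′ x xi ⟨
    evalN (node i true v φ′ (punchIn-∉ i)) x   ∎)
  where
  open ≡-Reasoning
  ρ-inj : Injective _≡_ _≡_ (punchIn i)
  ρ-inj = punchIn-injective i _ _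
  φ′ = rename (punchIn i) ρ-inj φ

𝒢-restrict : ∀ {F : BoolFun (suc n)} → Extensional F → ∀ i c →
             Has𝒢Restriction (restrict F i c) → Has𝒢Restriction F
𝒢-restrict {F = F} ext i c (m , σ , σ-inj , c₀ , h , restricts , h∈𝒢) =
  m , punchIn i ∘ σ , σ-inj ∘ punchIn-injective i _ _ , insertAt c₀ i c , h , restricts′ , h∈𝒢
  where
  restricts′ : RestrictsTo F (punchIn i ∘ σ) (insertAt c₀ i c) h
  restricts′ y x x∘σ≡y fixed = trans (restrict-removeAt ext xi≡c) (restricts y (removeAt x i) x∘σ≡y fixed′)
    where
    xi≡c : x i ≡ c
    xi≡c = trans (fixed i λ j → punchInᵢ≢i i (σ j)) (insertAt-lookup c₀ i c)
    fixed′ : ∀ k → (∀ j → σ j ≢ k) → removeAt x i k ≡ c₀ k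
    fixed′ k k∉σ =
      trans (fixed (punchIn i k) λ j → k∉σ j ∘ punchIn-injective i _ _) (insertAt-punchIn c₀ i c k)

-- The functions g_n

anyᶠ-true : ∀ {y : Vector Bool n} j → y j ≡ true → anyᶠ y ≡ true
anyᶠ-true {y = y} zero    y0≡1 = cong (_∨ anyᶠ (y ∘ suc)) y0≡1
anyᶠ-true {y = y} (suc j) yj≡1 = trans (cong (y zero ∨_) (anyᶠ-true j yj≡1)) (∨-zeroʳ (y zero))

anyᶠ-false : ∀ {y : Vector Bool n} → (∀ j → y j ≡ false) → anyᶠ y ≡ false
anyᶠ-false {zero}  _   = refl
anyᶠ-false {suc n} y≡0 = cong₂ _∨_ (y≡0 zero) (anyᶠ-false (y≡0 ∘ suc))

allᶠ-true : ∀ {y : Vector Bool n} → (∀ j → y j ≡ true) → allᶠ y ≡ true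
allᶠ-true {zero}  _   = refl
allᶠ-true {suc n} y≡1 = cong₂ _∧_ (y≡1 zero) (allᶠ-true (y≡1 ∘ suc))

allᶠ-false : ∀ {y : Vector Bool n} j → y j ≡ false → allᶠ y ≡ false
allᶠ-false {y = y} zero    y0≡0 = cong (_∧ allᶠ (y ∘ suc)) y0≡0
allᶠ-false {y = y} (suc j) yj≡0 = trans (cong (y zero ∧_) (allᶠ-false j yj≡0)) (∧-zeroʳ (y zero))

anyᶠ-cong : ∀ {y z : Vector Bool n} → y ≗ z → anyᶠ y ≡ anyᶠ z
anyᶠ-cong {zero}  _   = refl
anyᶠ-cong {suc n} y≗z = cong₂ _∨_ (y≗z zero) (anyᶠ-cong (y≗z ∘ suc))

allᶠ-cong : ∀ {y z : Vector Bool n} → y ≗ z → allᶠ y ≡ allᶠ z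
allᶠ-cong {zero}  _   = refl
allᶠ-cong {suc n} y≗z = cong₂ _∧_ (y≗z zero) (allᶠ-cong (y≗z ∘ suc))

gfun-cong : ∀ {y z : Vector Bool (suc n)} → y ≗ z → gfun y ≡ gfun z
gfun-cong y≗z = cong₂ _∨_ (cong₂ _∧_ (y≗z zero) (anyᶠ-cong (y≗z ∘ suc))) (allᶠ-cong (y≗z ∘ suc))

gfun-pair : ∀ {y : Vector Bool (suc n)} {c} j → y zero ≡ c → y (suc j) ≡ c → gfun y ≡ c
gfun-pair {y = y} {true} j y0≡1 yj≡1 =
  cong₂ (λ a b → (a ∧ b) ∨ allᶠ (y ∘ suc)) y0≡1 (anyᶠ-true j yj≡1)
gfun-pair {y = y} {false} j y0≡0 yj≡0 =
  trans (cong (λ a → (a ∧ anyᶠ (y ∘ suc)) ∨ allᶠ (y ∘ suc)) y0≡0) (allᶠ-false j yj≡0)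

gfun-isolated : ∀ {y : Vector Bool (suc n)} {c} → Fin n → y zero ≡ c → (∀ j → y (suc j) ≡ not c) →
                gfun y ≡ not c
gfun-isolated {y = y} {true} j y0≡1 rest≡0 =
  trans (cong₂ (λ a b → (a ∧ b) ∨ allᶠ (y ∘ suc)) y0≡1 (anyᶠ-false rest≡0)) (allᶠ-false j (rest≡0 j))
gfun-isolated {y = y} {false} _ y0≡0 rest≡1 =
  trans (cong (λ a → (a ∧ anyᶠ (y ∘ suc)) ∨ allᶠ (y ∘ suc)) y0≡0) (allᶠ-true rest≡1)

gfun-hits : ∀ (j : Fin (suc (suc (suc n)))) b v → ∃ λ y → y j ≡ b × gfun y ≡ v
gfun-hits {n} zero true true =
  const true , refl , gfun-pair {suc (suc n)} {λ _ → true} zero refl refl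
gfun-hits {n} zero false false =
  const false , refl , gfun-pair {suc (suc n)} {λ _ → false} zero refl refl
gfun-hits {n} zero true false =
  true ∷ const false , refl , gfun-isolated {suc (suc n)} {true ∷ const false} zero refl λ _ → refl
gfun-hits {n} zero false true =
  false ∷ const true , refl , gfun-isolated {suc (suc n)} {false ∷ const true} zero refl λ _ → refl
gfun-hits {n} (suc j) b v =
  y , updateAt-updates (suc j) (const v) , gfun-pair {y = y} (punchIn j zero) refl yk≡v
  where
  y : Vector Bool (suc (suc (suc n)))
  y = updateAt (const v) (suc j) (const b)
  yk≡v : y (suc (punchIn j zero)) ≡ v
  yk≡v = updateAt-minimal _ (suc j) {const b} (const v) (punchInᵢ≢i j zero ∘ suc-injective)

gfun-not-canalizing : ∀ (j : Fin (suc (suc (suc n)))) b v → ¬ Canalizes gfun j b v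
gfun-not-canalizing j b v can with gfun-hits j b (not v)
... | y , yj≡b , gy≡¬v = not-¬ refl (trans (sym (can y yj≡b)) gy≡¬v)

-- Negating variables

infixl 6 _⊕_
_⊕_ : Vector Bool n → Vector Bool n → Vector Bool n
(x ⊕ p) i = x i xor p i

⊕-involutive : ∀ (x p : Vector Bool n) → (x ⊕ p) ⊕ p ≗ x
⊕-involutive x p i = begin
  (x i xor p i) xor p i ≡⟨ xor-assoc (x i) (p i) (p i) ⟩
  x i xor (p i xor p i) ≡⟨ cong (x i xor_) (xor-same (p i)) ⟩
  x i xor false         ≡⟨ xor-identityʳ (x i) ⟩
  x i                   ∎
  where open ≡-Reasoning

literal-⊕ : ∀ (p : Vector Bool n) i b x → literal i (b xor p i) x ≡ literal i b (x ⊕ p)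
literal-⊕ p i b x = begin
  literal i (b xor p i) x     ≡⟨ literal-xor i (b xor p i) x ⟩
  not (b xor p i) xor x i     ≡⟨ cong (_xor x i) (not-distribˡ-xor b (p i)) ⟩
  (not b xor p i) xor x i     ≡⟨ xor-assoc (not b) (p i) (x i) ⟩
  not b xor (p i xor x i)     ≡⟨ cong (not b xor_) (xor-comm (p i) (x i)) ⟩
  not b xor (x i xor p i)     ≡⟨ literal-xor i b (x ⊕ p) ⟨
  literal i b (x ⊕ p)         ∎
  where open ≡-Reasoning

lro-⊕ : ∀ {f F : BoolFun n} p → (∀ x → f x ≡ F (x ⊕ p)) → IsLRO F → IsLRO f
lro-⊕ p f≡ (inj₁ (v , F≡v)) = inj₁ (v , λ x → trans (f≡ x) (F≡v _))
lro-⊕ p f≡ (inj₂ (_ , φ , F≡φ)) =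
  inj₂ (_ , relabel id id (λ i b → b xor p i) φ ,
        λ x → trans (f≡ x) (trans (F≡φ _) (sym (evalN-relabel (_⊕ p) (literal-⊕ p) φ x))))

In𝒢-⊕ : ∀ {h : BoolFun m} q → In𝒢 h → In𝒢 (λ y → h (y ⊕ q))
In𝒢-⊕ {zero} q ()
In𝒢-⊕ {suc m} q (m≥3 , neg , h≡g) =
  m≥3 , q ⊕ neg , λ y → trans (h≡g _) (gfun-cong λ j → xor-assoc (y j) (q j) (neg j))

𝒢-⊕ : ∀ {f F : BoolFun n} p → (∀ x → f x ≡ F (x ⊕ p)) → Has𝒢Restriction F → Has𝒢Restriction f
𝒢-⊕ {f = f} p f≡ (m , σ , σ-inj , c , h , restricts , h∈𝒢) =
  m , σ , σ-inj , c ⊕ p , (λ y → h (y ⊕ p ∘ σ)) , restricts′ , In𝒢-⊕ (p ∘ σ) h∈𝒢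
  where
  restricts′ : RestrictsTo f σ (c ⊕ p) λ y → h (y ⊕ p ∘ σ)
  restricts′ y x x∘σ≡y fixed = trans (f≡ x) (restricts _ (x ⊕ p) (λ j → cong (_xor p (σ j)) (x∘σ≡y j))
    λ k k∉σ → trans (cong (_xor p k) (fixed k k∉σ)) (⊕-involutive c p k))

negateAt : Vector Bool n → Vector ℚ n → Vector ℚ n
negateAt p w i = if p i then - w i else w i

weight-⊕ : ∀ (w : Vector ℚ n) p x → weight w (x ⊕ p) ≡ weight (negateAt p w) x + weight w p
weight-⊕ w p x =
  trans (sum-cong-≗ λ i → split (x i) (p i) (w i))
        (∑-distrib-+ (λ i → x i ·ᵇ negateAt p w i) (λ i → p i ·ᵇ w i))
  where
  split : ∀ a b q → (a xor b) ·ᵇ q ≡ a ·ᵇ (if b then - q else q) + b ·ᵇ q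
  split true  true  q = sym (ℚₚ.+-inverseˡ q)
  split false true  q = sym (ℚₚ.+-identityˡ q)
  split true  false q = sym (ℚₚ.+-identityʳ q)
  split false false q = refl

negation-to-nonneg : ∀ q → ∃ λ b → 0ℚ ≤ (if b then - q else q)
negation-to-nonneg q with q ℚₚ.<? 0ℚ
... | yes q<0 = true , ℚₚ.<⇒≤ (ℚₚ.neg-antimono-< q<0)
... | no  q≮0 = false , ℚₚ.≮⇒≥ q≮0

-- Lro functions have no restriction in 𝒢

constant-or-canalizing-≗ : ∀ {G H : BoolFun n} → (∀ x → G x ≡ H x) →
                           Constant G ⊎ Canalizing G → Constant H ⊎ Canalizing H
constant-or-canalizing-≗ G≡H (inj₁ (v , G≡v)) = inj₁ (v , λ x → trans (sym (G≡H x)) (G≡v x))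
constant-or-canalizing-≗ G≡H (inj₂ (i , b , v , can)) =
  inj₂ (i , b , v , λ x xi → trans (sym (G≡H x)) (can x xi))

module Embedding {σ : Fin m → Fin n} (σ-inj : Injective _≡_ _≡_ σ) (c : Vector Bool n) where

  embed : Vector Bool m → Vector Bool n
  embed y i with any? (λ j → σ j ≟ i)
  ... | yes (j , _) = y j
  ... | no  _       = c i

  embed-σ : ∀ y j → embed y (σ j) ≡ y j
  embed-σ y j with any? (λ j′ → σ j′ ≟ σ j)
  ... | yes (j′ , σj′≡σj) = cong y (σ-inj σj′≡σj)
  ... | no  ∄j′           = contradiction (j , refl) ∄j′

  embed-fixed : ∀ y i → (∀ j → σ j ≢ i) → embed y i ≡ c i
  embed-fixed y i i∉σ with any? (λ j → σ j ≟ i)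
  ... | yes (j , σj≡i) = contradiction σj≡i (i∉σ j)
  ... | no  _          = refl

  restriction-embed : ∀ {f : BoolFun n} {h} → RestrictsTo f σ c h → ∀ y → f (embed y) ≡ h y
  restriction-embed restricts y = restricts y (embed y) (embed-σ y) (embed-fixed y)

  literal-embed : ∀ i b → (∀ v → ∃₂ λ j d → ∀ y → y j ≡ d → literal i b (embed y) ≡ v)
                        ⊎ (∀ y → literal i b (embed y) ≡ literal i b c)
  literal-embed i b with any? (λ j → σ j ≟ i)
  ... | yes (j , σj≡i) = inj₁ λ v → j , not b xor v , λ y yj≡ →
          literal-attains i b v (embed y) (trans (subst (λ k → embed y k ≡ y j) σj≡i (embed-σ y j)) yj≡)
  ... | no  i∉σ        = inj₂ λ y → literal-cong i b (embed-fixed y i λ j σj≡i → i∉σ (j , σj≡i))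

  evalN-embed : ∀ {vs} (φ : Nested n vs) → Constant (evalN φ ∘ embed) ⊎ Canalizing (evalN φ ∘ embed)
  evalN-embed (lit i b) with literal-embed i b
  ... | inj₁ hits  = inj₂ (_ , _ , true , proj₂ (proj₂ (hits true)))
  ... | inj₂ fixed = inj₁ (literal i b c , fixed)
  evalN-embed (node i b v φ _) with literal-embed i b
  ... | inj₁ hits with hits v
  ...   | j , d , can = inj₂ (j , d , v , λ y yj≡d → node-canalizes v φ (embed y) (can y yj≡d))
  evalN-embed (node i b v φ _) | inj₂ fixed with literal i b c ≟ᵇ v
  ... | yes ℓ≡v = inj₁ (v , λ y → node-canalizes v φ (embed y) (trans (fixed y) ℓ≡v))
  ... | no  ℓ≢v = constant-or-canalizing-≗
                    (λ y → sym (node-passes v φ (embed y) (trans (fixed y) (¬-not ℓ≢v)))) (evalN-embed φ)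

  lro-embed : ∀ {f : BoolFun n} → IsLRO f → Constant (f ∘ embed) ⊎ Canalizing (f ∘ embed)
  lro-embed (inj₁ (v , f≡v))      = inj₁ (v , f≡v ∘ embed)
  lro-embed (inj₂ (_ , φ , f≡φ)) = constant-or-canalizing-≗ (λ y → sym (f≡φ (embed y))) (evalN-embed φ)

𝒢-not-constant-or-canalizing : ∀ {h : BoolFun m} → In𝒢 h → ¬ (Constant h ⊎ Canalizing h)
𝒢-not-constant-or-canalizing {zero} ()
𝒢-not-constant-or-canalizing {suc zero} (s≤s () , _)
𝒢-not-constant-or-canalizing {suc (suc zero)} (s≤s (s≤s ()) , _)
𝒢-not-constant-or-canalizing {suc (suc (suc m))} {h} (_ , neg , h≡g) = [ constant , canalizing ]′
  where
  canalizing : ¬ Canalizing h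
  canalizing (j , b , v , can) = gfun-not-canalizing j (b xor neg j) v λ z zj≡ → begin
    gfun z                 ≡⟨ gfun-cong (⊕-involutive z neg) ⟨
    gfun (z ⊕ neg ⊕ neg)   ≡⟨ h≡g (z ⊕ neg) ⟨
    h (z ⊕ neg)            ≡⟨ can (z ⊕ neg) (trans (cong (_xor neg j) zj≡) (⊕-involutive (const b) neg j)) ⟩
    v                      ∎
    where open ≡-Reasoning
  constant : ¬ Constant h
  constant (v , h≡v) = canalizing (zero , true , v , λ y _ → h≡v y)

lro⇒no𝒢 : ∀ {f : BoolFun n} → IsLRO f → ¬ Has𝒢Restriction f
lro⇒no𝒢 lro (m , σ , σ-inj , c , h , restricts , h∈𝒢) =
  𝒢-not-constant-or-canalizing h∈𝒢 (constant-or-canalizing-≗ (restriction-embed restricts) (lro-embed lro))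
  where open Embedding σ-inj c

-- Threshold functions with nonnegative weights

pairPoint : Fin n → Fin n → Bool → Vector Bool n
pairPoint i k c = updateAt (updateAt (const (not c)) i (const c)) k (const c)

pairPoint-i : ∀ {i k : Fin n} {c} → k ≢ i → pairPoint i k c i ≡ c
pairPoint-i {i = i} {k} {c} k≢i =
  trans (updateAt-minimal i k {const c} _ (k≢i ∘ sym)) (updateAt-updates i {const c} (const (not c)))

pairPoint-k : ∀ {i k : Fin n} {c} → pairPoint i k c k ≡ c
pairPoint-k {k = k} {c} = updateAt-updates k {const c} _

pairPoint-elsewhere : ∀ {i k j : Fin n} {c} → j ≢ i → j ≢ k → pairPoint i k c j ≡ not c
pairPoint-elsewhere {i = i} {k} {j} {c} j≢i j≢k =
  trans (updateAt-minimal j k {const c} _ j≢k) (updateAt-minimal j i {const c} (const (not c)) j≢i)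

Forces : BoolFun n → Fin n → Fin n → Bool → Set
Forces F i k c = ∀ x → x i ≡ c → x k ≡ c → F x ≡ c

module Forcing {F : BoolFun n} {u t} (u≥0 : Nonnegative u) (rep : Represents u t F) where
  open Threshold rep
  open ℚₚ.≤-Reasoning

  forces-true⇒heavy : ∀ {i k} → k ≢ i → Forces F i k true → t < u i + u k
  forces-true⇒heavy {i} {k} k≢i forces = begin-strict
    t                             <⟨ true⇒above (forces p (pairPoint-i k≢i) (pairPoint-k {i = i})) ⟩
    weight u p                    ≤⟨ weight-≤-pair u≥0 k≢i (λ j j≢i j≢k → pairPoint-elsewhere j≢i j≢k) ⟩
    u i + u k                     ∎
    where p = pairPoint i k true

  heavy⇒forces-true : ∀ {i k} → k ≢ i → t < u i + u k → Forces F i k true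
  heavy⇒forces-true k≢i heavy x xi≡1 xk≡1 =
    above⇒true (ℚₚ.<-≤-trans heavy (weight-≥-pair u≥0 k≢i xi≡1 xk≡1))

  forces-false⇒light : ∀ {i k} → k ≢ i → Forces F i k false → sum u ≤ t + (u i + u k)
  forces-false⇒light {i} {k} k≢i forces = begin
    sum u                                ≡⟨ weight-+-weight-not u p ⟨
    weight u p + weight u (not ∘ p)
      ≤⟨ ℚₚ.+-mono-≤ (false⇒below (forces p (pairPoint-i k≢i) (pairPoint-k {i = i})))
                     (weight-≤-pair u≥0 k≢i λ j j≢i j≢k → cong not (pairPoint-elsewhere j≢i j≢k)) ⟩
    t + (u i + u k)                      ∎
    where p = pairPoint i k false

  light⇒forces-false : ∀ {i k} → k ≢ i → sum u ≤ t + (u i + u k) → Forces F i k false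
  light⇒forces-false {i} {k} k≢i light x xi≡0 xk≡0 = below⇒false (+-cancelʳ-≤ (weight u (not ∘ x)) (begin
    weight u x + weight u (not ∘ x) ≡⟨ weight-+-weight-not u x ⟩
    sum u                           ≤⟨ light ⟩
    t + (u i + u k)                 ≤⟨ ℚₚ.+-monoʳ-≤ t (weight-≥-pair u≥0 k≢i (cong not xi≡0) (cong not xk≡0)) ⟩
    t + weight u (not ∘ x)          ∎))

  forces-mono : ∀ {i k i′ k′ c} → k ≢ i → k′ ≢ i′ → u i + u k ≤ u i′ + u k′ →
                Forces F i k c → Forces F i′ k′ c
  forces-mono {c = true}  k≢i k′≢i′ ≤′ forces =
    heavy⇒forces-true k′≢i′ (ℚₚ.<-≤-trans (forces-true⇒heavy k≢i forces) ≤′)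
  forces-mono {c = false} k≢i k′≢i′ ≤′ forces =
    light⇒forces-false k′≢i′ (ℚₚ.≤-trans (forces-false⇒light k≢i forces) (ℚₚ.+-monoʳ-≤ t ≤′))

module _ {F : BoolFun (suc n)} {u t} (u≥0 : Nonnegative u) (rep : Represents u t F) where
  open Threshold {u = u} rep
  open ℚₚ.≤-Reasoning

  fixes-or-canalizes : ∀ i → (∀ c → FixesConstants (restrict F i c)) ⊎ (∃ λ v → Canalizes F i v v)
  fixes-or-canalizes i with u i ℚₚ.≤? t | sum (removeAt u i) ℚₚ.≤? t
  ... | no ui≰t | _ =
    inj₂ (true , λ x xi≡1 → above⇒true (ℚₚ.<-≤-trans (ℚₚ.≰⇒> ui≰t) (weight-≥-single u≥0 {x} xi≡1)))
  ... | yes _ | yes rest≤t = inj₂ (false , λ x xi≡0 → below⇒false (weight≤t x xi≡0))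
    where
    weight≤t : ∀ x → x i ≡ false → weight u x ≤ t
    weight≤t x xi≡0 = begin
      weight u x                 ≡⟨ weight-removeAt u x i ⟩
      x i ·ᵇ u i + rest          ≡⟨ cong (λ b → b ·ᵇ u i + rest) xi≡0 ⟩
      0ℚ + rest                  ≡⟨ ℚₚ.+-identityˡ rest ⟩
      rest                       ≤⟨ weight-≤-sum (u≥0 ∘ punchIn i) (removeAt x i) ⟩
      sum (removeAt u i)         ≤⟨ rest≤t ⟩
      t                          ∎
      where rest = weight (removeAt u i) (removeAt x i)
  ... | yes ui≤t | no rest≰t = inj₁ fixes
    where
    fixes : ∀ c b → F (insertAt (const b) i c) ≡ b
    fixes c false = below⇒false (begin
      weight u (insertAt (const false) i c)           ≡⟨ weight-insertAt u (const false) i c ⟩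
      weight (removeAt u i) (const false) + c ·ᵇ u i
        ≡⟨ cong (_+ c ·ᵇ u i) (weight-zero (removeAt u i) λ _ → refl) ⟩
      0ℚ + c ·ᵇ u i                                   ≡⟨ ℚₚ.+-identityˡ _ ⟩
      c ·ᵇ u i                                        ≤⟨ ·ᵇ-≤ c (u≥0 i) ⟩
      u i                                             ≤⟨ ui≤t ⟩
      t                                               ∎)
    fixes c true = above⇒true (begin-strict
      t                                               <⟨ ℚₚ.≰⇒> rest≰t ⟩
      sum (removeAt u i)                              ≡⟨ ℚₚ.+-identityʳ (sum (removeAt u i)) ⟨
      sum (removeAt u i) + 0ℚ                         ≤⟨ ℚₚ.+-monoʳ-≤ (sum (removeAt u i)) (·ᵇ-nonneg c (u≥0 i)) ⟩
      sum (removeAt u i) + c ·ᵇ u i                   ≡⟨ weight-insertAt u (const true) i c ⟨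
      weight u (insertAt (const true) i c)            ∎)

insertAt-const-≢ : ∀ {a c : Bool} {i j : Fin (suc n)} → j ≢ i → insertAt (const a) i c j ≡ a
insertAt-const-≢ {a = a} {c} {i} j≢i =
  trans (cong (insertAt (const a) i c) (sym (punchIn-punchOut (j≢i ∘ sym))))
        (insertAt-punchIn (const a) i c _)

heaviest : (u : Vector ℚ (suc n)) → ∃ λ a → ∀ k → u k ≤ u a
heaviest {n} u = argmax u zero (allFin (suc n)) ,
  λ k → All.lookup (f[xs]≤f[argmax] {f = u} zero (allFin (suc n))) (∈-allFin k)

module AllRestrictionsLRO {F : BoolFun (suc n)} {u t} (u≥0 : Nonnegative u) (rep : Represents u t F)
  (fixes : ∀ i c → FixesConstants (restrict F i c)) (lro : ∀ i c → IsLRO (restrict F i c)) where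
  open Threshold {u = u} rep
  open Forcing {u = u} u≥0 rep

  forcing-partner : ∀ i c → ∃ λ k → k ≢ i × Forces F i k c
  forcing-partner i c with lro i c
  ... | inj₁ const = contradiction const (fixes⇒nonconstant (fixes i c))
  ... | inj₂ (_ , φ , restriction≡φ) with evalN-canalizing φ
  ...   | j , b , v , φ-can =
    k , punchInᵢ≢i i j , λ x xi≡c xk≡c → trans (F-can x xi≡c (trans xk≡c (sym b≡c))) b≡c
    where
    k = punchIn i j
    restriction-can : Canalizes (restrict F i c) j b v
    restriction-can y yj≡b = trans (restriction≡φ y) (φ-can y yj≡b)
    F-can : ∀ x → x i ≡ c → x k ≡ b → F x ≡ b
    F-can x xi≡c xk≡b = trans (restrict-removeAt respects-≗ xi≡c)
      (trans (restriction-can _ xk≡b) (canalizing-value (fixes i c) restriction-can))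
    -- evaluate F at the point that is c everywhere except for x_k = b
    b≡c : b ≡ c
    b≡c = trans (sym (F-can _ (insertAt-const-≢ (punchInᵢ≢i i j ∘ sym)) (insertAt-lookup _ k b)))
                (fixes k b c)

  module Heaviest (a : Fin (suc n)) (u≤u[a] : ∀ k → u k ≤ u a) where
    forces-with-heaviest : ∀ c k → k ≢ a → Forces F a k c
    forces-with-heaviest c k k≢a with forcing-partner k c
    ... | j , j≢k , forces = forces-mono j≢k k≢a
      (ℚₚ.≤-trans (ℚₚ.+-monoʳ-≤ (u k) (u≤u[a] j)) (ℚₚ.≤-reflexive (ℚₚ.+-comm (u k) (u a)))) forces

    π : Fin (suc n) → Fin (suc n)
    π = a ∷ punchIn a

    π-injective : Injective _≡_ _≡_ π
    π-injective {zero}  {zero}   _ = refl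
    π-injective {zero}  {suc j}  e = contradiction (sym e) (punchInᵢ≢i a j)
    π-injective {suc j} {zero}   e = contradiction e (punchInᵢ≢i a j)
    π-injective {suc j} {suc j′} e = cong suc (punchIn-injective a j j′ e)

    F≡gfun : ∀ x y → (∀ j → x (π j) ≡ y j) → F x ≡ gfun y
    -- Either some other variable agrees with x_a, and the pair forces the value x_a, or x is a
    -- constant point with x_a flipped.
    F≡gfun x y x∘π≡y with any? (λ j → x (punchIn a j) ≟ᵇ x a)
    ... | yes (j , xj≡xa) =
      trans (forces-with-heaviest (x a) (punchIn a j) (punchInᵢ≢i a j) x refl xj≡xa)
            (sym (gfun-pair {y = y} j (sym (x∘π≡y zero)) (trans (sym (x∘π≡y (suc j))) xj≡xa)))
    ... | no ∄j =
      trans (respects-≗ x≗) (trans (fixes a (x a) (not (x a)))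
            (sym (gfun-isolated {y = y} other (sym (x∘π≡y zero)) λ j →
                    trans (sym (x∘π≡y (suc j))) (others j))))
      where
      others : ∀ j → x (punchIn a j) ≡ not (x a)
      others j = ¬-not λ xj≡xa → ∄j (j , xj≡xa)
      other : Fin n
      other = punchOut (proj₁ (proj₂ (forcing-partner a true)) ∘ sym)
      x≗ : x ≗ insertAt (const (not (x a))) a (x a)
      x≗ k with k ≟ a
      ... | yes refl = sym (insertAt-lookup _ a (x a))
      ... | no  k≢a  = trans (cong x (sym (punchIn-punchOut (k≢a ∘ sym))))
                             (trans (others _) (sym (insertAt-const-≢ k≢a)))

    𝒢-restriction : suc n ≥ 3 → Has𝒢Restriction F
    𝒢-restriction n≥3 =
      suc n , π , π-injective , const false , gfun , (λ y x x∘π≡y _ → F≡gfun x y x∘π≡y) ,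
      n≥3 , const false , λ y → gfun-cong λ j → sym (xor-identityʳ (y j))

all-restrictions-lro⇒𝒢 : ∀ {F : BoolFun (suc n)} {u t} → Nonnegative u → Represents u t F →
                         (∀ i c → FixesConstants (restrict F i c)) → (∀ i c → IsLRO (restrict F i c)) →
                         Has𝒢Restriction F
all-restrictions-lro⇒𝒢 {zero} {F} {u} u≥0 rep fixes lro
  with AllRestrictionsLRO.forcing-partner {F = F} {u} u≥0 rep fixes lro zero true
... | zero , 0≢0 , _ = contradiction refl 0≢0
all-restrictions-lro⇒𝒢 {suc zero} {F} {u} u≥0 rep fixes lro =
  -- the point (0, 1) lies in both restrictions x₀ = 0 and x₁ = 1, and would be mapped to 1 and to 0
  contradiction (trans (sym (fixes zero false true)) (trans (respects-≗ same) (fixes (suc zero) true false)))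
                λ ()
  where
  open Threshold {F = F} {u} rep
  same : insertAt (const true) zero false ≗ insertAt (const false) (suc zero) true
  same zero       = refl
  same (suc zero) = refl
all-restrictions-lro⇒𝒢 {suc (suc n)} {F} {u} u≥0 rep fixes lro =
  Heaviest.𝒢-restriction (proj₁ (heaviest u)) (proj₂ (heaviest u)) (s≤s (s≤s (s≤s z≤n)))
  where open AllRestrictionsLRO {F = F} {u} u≥0 rep fixes lro

∀⊎∃ : ∀ {P Q : Fin n → Set} → (∀ i → P i ⊎ Q i) → (∀ i → P i) ⊎ ∃ Q
∀⊎∃ {zero}  _   = inj₁ λ ()
∀⊎∃ {suc n} P⊎Q with P⊎Q zero | ∀⊎∃ (P⊎Q ∘ suc)
... | inj₂ q | _            = inj₂ (zero , q)
... | inj₁ _ | inj₂ (i , q) = inj₂ (suc i , q)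
... | inj₁ p | inj₁ ps      = inj₁ λ { zero → p ; (suc i) → ps i }

lro-or-𝒢 : ∀ n {F : BoolFun n} {u t} → Nonnegative u → Represents u t F → IsLRO F ⊎ Has𝒢Restriction F
lro-or-𝒢 zero {F} {u} _ rep = inj₁ (inj₁ (F (λ ()) , λ x → respects-≗ λ ()))
  where open Threshold {u = u} rep
lro-or-𝒢 (suc n) {F} {u} u≥0 rep = [ all-fix , some-canalizes ]′ (∀⊎∃ (fixes-or-canalizes u≥0 rep))
  where
  open Threshold {u = u} rep
  restriction : ∀ i c → IsLRO (restrict F i c) ⊎ Has𝒢Restriction F
  restriction i c = ⊎-map id (𝒢-restrict respects-≗ i c)
    (lro-or-𝒢 n (u≥0 ∘ punchIn i) (represents-restrict {u = u} rep i c))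
  both-restrictions : ∀ i → (∀ c → IsLRO (restrict F i c)) ⊎ Has𝒢Restriction F
  both-restrictions i with restriction i true | restriction i false
  ... | inj₁ lro₁ | inj₁ lro₀ = inj₁ λ { true → lro₁ ; false → lro₀ }
  ... | inj₂ 𝒢    | _         = inj₂ 𝒢
  ... | inj₁ _    | inj₂ 𝒢    = inj₂ 𝒢
  all-fix : (∀ i c → FixesConstants (restrict F i c)) → IsLRO F ⊎ Has𝒢Restriction F
  all-fix fixes = [ inj₂ ∘ all-restrictions-lro⇒𝒢 u≥0 rep fixes , inj₂ ∘ proj₂ ]′ (∀⊎∃ both-restrictions)
  some-canalizes : (∃ λ i → ∃ λ v → Canalizes F i v v) → IsLRO F ⊎ Has𝒢Restriction F
  some-canalizes (i , v , can) = ⊎-map (lro-canalized respects-≗ can) id (restriction i (not v))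

threshold⇒lro-or-𝒢 : ∀ {f : BoolFun n} → IsThreshold f → IsLRO f ⊎ Has𝒢Restriction f
threshold⇒lro-or-𝒢 {n} {f} f-threshold with w , t , rep ← isThreshold⇒represents f-threshold =
  ⊎-map (lro-⊕ p f≡) (𝒢-⊕ p f≡) (lro-or-𝒢 n (proj₂ ∘ negation-to-nonneg ∘ w) rep⊕)
  where
  p = proj₁ ∘ negation-to-nonneg ∘ w
  rep⊕ : Represents (negateAt p w) (t - weight w p) (λ x → f (x ⊕ p))
  rep⊕ = represents-shift {w = w} (_⊕ p) (weight-⊕ w p) rep
  f≡ : ∀ x → f x ≡ f (x ⊕ p ⊕ p)
  f≡ x = Threshold.respects-≗ {u = w} rep λ i → sym (⊕-involutive x p i)

theorem8 : (n : ℕ) (f : BoolFun n) → IsThreshold f →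
           (IsLRO f ⇔ (¬ Has𝒢Restriction f))
theorem8 n f f-threshold =
  mk⇔ lro⇒no𝒢 λ no𝒢 → fromInj₁ (⊥-elim ∘ no𝒢) (threshold⇒lro-or-𝒢 f-threshold)
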